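{- Suppose $\mathbb{M}$ is dense (for all $a<b$ in $\mathbb{M}$ there is $c$ with $a<c<b$) and endowed with a compatible subtraction operation (for all $x<y$ there is $z$ with $x+z=y$). Let $\varphi$ be a TEL formula and $u,v,w$ time terms. Then for every environment $\mathcal{E}=(\alpha,\beta,\eta)$ with $\beta(u+v)=\beta(w)$ and every $s\in\mathbb{M}^+$: $(\mathcal{E},s)\models\Diamond_u(\Diamond_v\varphi)$ iff $(\mathcal{E},s)\models\Diamond_w\varphi$, and $(\mathcal{E},s)\models\Box_u(\Box_v\varphi)$ iff $(\mathcal{E},s)\models\Box_w\varphi$.
   Context: Let $(\mathbb{M},+,0)$ be a commutative monoid with a total order $<$ compatible with $+$, such that $a<b$ iff $a+c=b$ for some $c>0$, and $a<a+x$ for all $a$ and all $x\neq0$; let $\mathbb{M}^+$ be its set of positive elements. TEL time terms: $s,t ::= a\mid x\mid s+t$ ($a$ a time constant, $x$ from a countable set $\mathsf{Var}$ of time variables); $\mathsf{Term}$ is the set of terms. TEL formulas: $\varphi,\psi ::= p\mid\varphi_t\mid\neg\varphi\mid\varphi\wedge\psi\mid\varphi\vee\psi\mid\Box_t\varphi\mid\Diamond_t\varphi\mid\exists x\varphi\mid\forall x\varphi$, with $p$ from a set $\mathsf{Prop}$. An environment is $\mathcal{E}=(\alpha,\beta,\eta)$ with $\alpha:\mathbb{M}^+\to 2^{\mathsf{Prop}}$, $\beta:\mathsf{Term}\to\mathbb{M}^+$ satisfying $\beta(s+t)=\beta(s)+\beta(t)$, $\eta:\mathsf{Var}\to\mathbb{M}^+$.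 Satisfaction at $s\in\mathbb{M}^+$: $(\mathcal{E},s)\models p$ iff $p\in\alpha(s)$; Boolean connectives as usual; $(\mathcal{E},s)\models\varphi_t$ iff $(\mathcal{E},s+\beta(t))\models\varphi$; $(\mathcal{E},s)\models\Diamond_t\varphi$ iff $(\mathcal{E},u)\models\varphi$ for some $u$ with $s\le u<s+\beta(t)$; $(\mathcal{E},s)\models\Box_t\varphi$ iff $(\mathcal{E},u)\models\varphi$ for all $u$ with $s\le u<s+\beta(t)$; $(\mathcal{E},s)\models\exists x\varphi$ (resp. $\forall x\varphi$) iff for some (resp. all) $a\in\mathbb{M}^+$, $(\mathcal{E}',s)\models\varphi$, where $\mathcal{E}'$ is $\mathcal{E}$ with $\eta$ replaced by $\eta[x:=a]$. -}

module Defs where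

open import Data.Nat using (ℕ)
open import Data.Nat.Properties using () renaming (_≟_ to _≟ℕ_)
open import Data.Product using (Σ; Σ-syntax; ∃; _×_; _,_; proj₁; proj₂)
open import Data.Sum using (_⊎_)
open import Relation.Nullary using (¬_; yes; no)
open import Relation.Binary.PropositionalEquality using (_≡_; _≢_; refl; subst)
open import Relation.Binary.Definitions using (Trichotomous)

record TimeMonoid : Set₁ where
  infixl 6 _+_
  infix 4 _<_ _≤_
  field
    Carrier   : Set
    _+_       : Carrier → Carrier → Carrier
    0#        : Carrier
    +-assoc   : ∀ a b c → (a + b) + c ≡ a + (b + c)
    +-comm    : ∀ a b → a + b ≡ b + a
    +-identityˡ : ∀ a → 0# + a ≡ a
    _<_       : Carrier → Carrier → Set
    <-irrefl  : ∀ a → ¬ (a < a)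
    <-trans   : ∀ {a b c} → a < b → b < c → a < c
    <-tri     : Trichotomous _≡_ _<_

  _≤_ : Carrier → Carrier → Set
  a ≤ b = a < b ⊎ a ≡ b

  field
    +-mono-≤  : ∀ {a b} c → a ≤ b → a + c ≤ b + c
    <⇒∃       : ∀ {a b} → a < b → Σ[ c ∈ Carrier ] (0# < c × a + c ≡ b)
    ∃⇒<       : ∀ {a b c} → 0# < c → a + c ≡ b → a < b
    <-+       : ∀ a x → x ≢ 0# → a < a + x

  M⁺ : Set
  M⁺ = Σ[ a ∈ Carrier ] (0# < a)

  +-pos : ∀ {a b} → 0# < a → 0# < b → 0# < a + b
  +-pos {a} {b} 0<a 0<b = <-trans 0<a (<-+ a b (λ b≡0 → <-irrefl 0# (subst (0# <_) b≡0 0<b)))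

  _+⁺_ : M⁺ → M⁺ → M⁺
  (a , p) +⁺ (b , q) = (a + b , +-pos p q)

Dense : TimeMonoid → Set
Dense M = ∀ {a b} → a < b → Σ[ c ∈ Carrier ] (a < c × c < b)
  where open TimeMonoid M

HasSubtraction : TimeMonoid → Set
HasSubtraction M = ∀ {x y} → x < y → Σ[ z ∈ Carrier ] (x + z ≡ y)
  where open TimeMonoid M

module TEL (M : TimeMonoid) (Prop : Set) where
  open TimeMonoid M

  Var : Set
  Var = ℕ

  infixl 6 _⊕_
  data Term : Set where
    con : M⁺ → Term
    var : Var → Term
    _⊕_ : Term → Term → Term

  data Formula : Set where
    atom : Prop → Formula
    at   : Formula → Term → Formula
    ¬'   : Formula → Formula
    _∧'_ : Formula → Formula → Formula
    _∨'_ : Formula → Formula → Formula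
    □    : Term → Formula → Formula
    ◇    : Term → Formula → Formula
    ∃'   : Var → Formula → Formula
    ∀'   : Var → Formula → Formula

  -- environments (α, β, η); α(s) ⊆ Prop is given as a predicate on Prop
  record Env : Set₁ where
    field
      α     : M⁺ → Prop → Set
      β     : Term → M⁺
      β-add : ∀ s t → proj₁ (β (s ⊕ t)) ≡ proj₁ (β s) + proj₁ (β t)
      η     : Var → M⁺

  update : (Var → M⁺) → Var → M⁺ → Var → M⁺
  update η x a y with y ≟ℕ x
  ... | yes _ = a
  ... | no  _ = η y

  _[_≔_] : Env → Var → M⁺ → Env
  E [ x ≔ a ] = record
    { α = Env.α E ; β = Env.β E ; β-add = Env.β-add E
    ; η = update (Env.η E) x a }

  ⟨_,_⟩⊨_ : Env → M⁺ → Formula → Set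
  ⟨ E , s ⟩⊨ atom p = Env.α E s p
  ⟨ E , s ⟩⊨ at φ t = ⟨ E , s +⁺ Env.β E t ⟩⊨ φ
  ⟨ E , s ⟩⊨ ¬' φ = ¬ (⟨ E , s ⟩⊨ φ)
  ⟨ E , s ⟩⊨ (φ ∧' ψ) = (⟨ E , s ⟩⊨ φ) × (⟨ E , s ⟩⊨ ψ)
  ⟨ E , s ⟩⊨ (φ ∨' ψ) = (⟨ E , s ⟩⊨ φ) ⊎ (⟨ E , s ⟩⊨ ψ)
  ⟨ E , s ⟩⊨ □ t φ = (u : M⁺) → proj₁ s ≤ proj₁ u → proj₁ u < proj₁ (s +⁺ Env.β E t) → ⟨ E , u ⟩⊨ φ
  ⟨ E , s ⟩⊨ ◇ t φ = Σ[ u ∈ M⁺ ] (proj₁ s ≤ proj₁ u × proj₁ u < proj₁ (s +⁺ Env.β E t) × ⟨ E , u ⟩⊨ φ)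
  ⟨ E , s ⟩⊨ ∃' x φ = Σ[ a ∈ M⁺ ] (⟨ E [ x ≔ a ] , s ⟩⊨ φ)
  ⟨ E , s ⟩⊨ ∀' x φ = (a : M⁺) → ⟨ E [ x ≔ a ] , s ⟩⊨ φ

-- The window [s, s + β u + β v) is the union of the windows [x, x + β v) for x in
-- [s, s + β u), which gives both equivalences at once.  Only the covering needs
-- density: for y ≥ s + β u, write y + e = s + β u + β v, pick 0 < c < e and take
-- x < s + β u with s + β u ≤ x + c; then y + c < x + β v + c.
module Submission where

open import Defs
open import Data.Product using (_×_; proj₁; proj₂; Σ-syntax; _,_)
open import Data.Sum using (_⊎_; inj₁; inj₂)
open import Data.Empty using (⊥-elim)
open import Function.Bundles using (_⇔_; mk⇔)
open import Relation.Binary.PropositionalEquality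
  using (_≡_; refl; sym; cong; subst; resp₂; isEquivalence; module ≡-Reasoning)
open import Relation.Binary.Definitions using (tri<; tri≈; tri>)

module TimeMonoidProperties (M : TimeMonoid) where
  open TimeMonoid M
  open ≡-Reasoning
  import Relation.Binary.Construct.StrictToNonStrict _≡_ _<_ as NonStrict

  ≤-trans : ∀ {a b c} → a ≤ b → b ≤ c → a ≤ c
  ≤-trans = NonStrict.trans isEquivalence (resp₂ _<_) <-trans

  <-≤-trans : ∀ {a b c} → a < b → b ≤ c → a < c
  <-≤-trans = NonStrict.<-≤-trans <-trans (proj₁ (resp₂ _<_))

  <-or-≥ : ∀ a b → a < b ⊎ b ≤ a
  <-or-≥ a b with <-tri a b
  ... | tri< a<b _ _ = inj₁ a<b
  ... | tri≈ _ a≡b _ = inj₂ (inj₂ (sym a≡b))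
  ... | tri> _ _ b<a = inj₂ (inj₁ b<a)

  x<x+y : ∀ x {y} → 0# < y → x < x + y
  x<x+y x 0<y = ∃⇒< 0<y refl

  +-swapʳ : ∀ a b c → a + b + c ≡ a + c + b
  +-swapʳ a b c = begin
    a + b + c   ≡⟨ +-assoc a b c ⟩
    a + (b + c) ≡⟨ cong (a +_) (+-comm b c) ⟩
    a + (c + b) ≡⟨ +-assoc a c b ⟨
    a + c + b   ∎

  +-monoˡ-< : ∀ c {a b} → a < b → a + c < b + c
  +-monoˡ-< c {a} a<b with <⇒∃ a<b
  ... | k , 0<k , a+k≡b = ∃⇒< 0<k (begin
    a + c + k ≡⟨ +-swapʳ a c k ⟩
    a + k + c ≡⟨ cong (_+ c) a+k≡b ⟩
    _ + c     ∎)

  +-monoʳ-< : ∀ c {a b} → a < b → c + a < c + b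
  +-monoʳ-< c {a} {b} a<b = subst₂< (+-comm a c) (+-comm b c) (+-monoˡ-< c a<b)
    where
    subst₂< : ∀ {x x′ y y′} → x ≡ x′ → y ≡ y′ → x < y → x′ < y′
    subst₂< refl refl p = p

  +-cancelʳ-< : ∀ c {a b} → a + c < b + c → a < b
  +-cancelʳ-< c {a} {b} a+c<b+c with <-tri a b
  ... | tri< a<b _ _ = a<b
  ... | tri≈ _ refl _ = ⊥-elim (<-irrefl _ a+c<b+c)
  ... | tri> _ _ b<a = ⊥-elim (<-irrefl _ (<-trans a+c<b+c (+-monoˡ-< c b<a)))

  ∃-within-below : ∀ s {U c} → 0# < U → 0# < c →
                   Σ[ x ∈ Carrier ] (s ≤ x × x < s + U × s + U ≤ x + c)
  ∃-within-below s {U} {c} 0<U 0<c with <-tri c U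
  ... | tri≈ _ refl _ = s , inj₂ refl , x<x+y s 0<U , inj₂ refl
  ... | tri> _ _ U<c  = s , inj₂ refl , x<x+y s 0<U , inj₁ (+-monoʳ-< s U<c)
  ... | tri< c<U _ _ with <⇒∃ c<U
  ...   | z , 0<z , c+z≡U = s + z , inj₁ (x<x+y s 0<z) , ∃⇒< 0<c s+z+c≡s+U , inj₂ (sym s+z+c≡s+U)
    where
    s+z+c≡s+U : s + z + c ≡ s + U
    s+z+c≡s+U = begin
      s + z + c   ≡⟨ +-assoc s z c ⟩
      s + (z + c) ≡⟨ cong (s +_) (+-comm z c) ⟩
      s + (c + z) ≡⟨ cong (s +_) c+z≡U ⟩
      s + U       ∎

  window-merge : ∀ {s U V x y} → x < s + U → y < x + V → y < s + U + V
  window-merge {V = V} x<s+U y<x+V = <-trans y<x+V (+-monoˡ-< V x<s+U)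

  module _ (dense : Dense M) where

    ∃-start-reaching : ∀ s {U V y} → 0# < U → y < s + U + V →
                       Σ[ x ∈ Carrier ] (s ≤ x × x < s + U × y < x + V)
    ∃-start-reaching s {U} {V} {y} 0<U y<s+U+V with <⇒∃ y<s+U+V
    ... | e , 0<e , y+e≡s+U+V with dense 0<e
    ...   | c , 0<c , c<e with ∃-within-below s 0<U 0<c
    ...     | x , s≤x , x<s+U , s+U≤x+c = x , s≤x , x<s+U , +-cancelʳ-< c y+c<x+V+c
      where
      y+c<x+V+c : y + c < x + V + c
      y+c<x+V+c = <-≤-trans (subst (y + c <_) y+e≡s+U+V (+-monoʳ-< y c<e))
                            (subst (s + U + V ≤_) (+-swapʳ x c V) (+-mono-≤ V s+U≤x+c))

    window-split : ∀ {s U V y} → 0# < U → 0# < V → s ≤ y → y < s + U + V →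
                   Σ[ x ∈ Carrier ] (s ≤ x × x < s + U × x ≤ y × y < x + V)
    window-split {s} {U} {V} {y} 0<U 0<V s≤y y<s+U+V with <-or-≥ y (s + U)
    ... | inj₁ y<s+U = y , s≤y , y<s+U , inj₂ refl , x<x+y y 0<V
    ... | inj₂ s+U≤y with ∃-start-reaching s 0<U y<s+U+V
    ...   | x , s≤x , x<s+U , y<x+V = x , s≤x , x<s+U , inj₁ (<-≤-trans x<s+U s+U≤y) , y<x+V

module Nesting (M : TimeMonoid) (dense : Dense M) (Prop : Set) where
  open TimeMonoid M
  open TEL M Prop
  open TimeMonoidProperties M

  module _ (E : Env) {u v w : Term} (β-split : proj₁ (Env.β E (u ⊕ v)) ≡ proj₁ (Env.β E w)) where
    private
      U V W : Carrier
      U = proj₁ (Env.β E u)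
      V = proj₁ (Env.β E v)
      W = proj₁ (Env.β E w)

      s+U+V≡s+W : ∀ s → s + U + V ≡ s + W
      s+U+V≡s+W s = begin
        s + U + V   ≡⟨ +-assoc s U V ⟩
        s + (U + V) ≡⟨ cong (s +_) (Env.β-add E u v) ⟨
        s + proj₁ (Env.β E (u ⊕ v)) ≡⟨ cong (s +_) β-split ⟩
        s + W       ∎
        where open ≡-Reasoning

      merge : ∀ {s x y} → x < s + U → y < x + V → y < s + W
      merge {s} x<s+U y<x+V = subst (_ <_) (s+U+V≡s+W s) (window-merge x<s+U y<x+V)

      split : ∀ {s y} → s ≤ y → y < s + W →
              Σ[ x ∈ Carrier ] (s ≤ x × x < s + U × x ≤ y × y < x + V)
      split {s} s≤y y<s+W = window-split dense (proj₂ (Env.β E u)) (proj₂ (Env.β E v)) s≤y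
                              (subst (_ <_) (sym (s+U+V≡s+W s)) y<s+W)

    ◇◇⇔◇ : ∀ φ s → (⟨ E , s ⟩⊨ ◇ u (◇ v φ)) ⇔ (⟨ E , s ⟩⊨ ◇ w φ)
    ◇◇⇔◇ φ s = mk⇔ to from
      where
      to : ⟨ E , s ⟩⊨ ◇ u (◇ v φ) → ⟨ E , s ⟩⊨ ◇ w φ
      to (_ , s≤x , x<s+U , y , x≤y , y<x+V , ⊨φ) = y , ≤-trans s≤x x≤y , merge x<s+U y<x+V , ⊨φ

      from : ⟨ E , s ⟩⊨ ◇ w φ → ⟨ E , s ⟩⊨ ◇ u (◇ v φ)
      from (y , s≤y , y<s+W , ⊨φ) with split s≤y y<s+W
      ... | x , s≤x , x<s+U , x≤y , y<x+V =
        (x , <-≤-trans (proj₂ s) s≤x) , s≤x , x<s+U , y , x≤y , y<x+V , ⊨φ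

    □□⇔□ : ∀ φ s → (⟨ E , s ⟩⊨ □ u (□ v φ)) ⇔ (⟨ E , s ⟩⊨ □ w φ)
    □□⇔□ φ s = mk⇔ to from
      where
      to : ⟨ E , s ⟩⊨ □ u (□ v φ) → ⟨ E , s ⟩⊨ □ w φ
      to ⊨□□φ y s≤y y<s+W with split s≤y y<s+W
      ... | x , s≤x , x<s+U , x≤y , y<x+V =
        ⊨□□φ (x , <-≤-trans (proj₂ s) s≤x) s≤x x<s+U y x≤y y<x+V

      from : ⟨ E , s ⟩⊨ □ w φ → ⟨ E , s ⟩⊨ □ u (□ v φ)
      from ⊨□φ _ s≤x x<s+U y x≤y y<x+V = ⊨□φ y (≤-trans s≤x x≤y) (merge x<s+U y<x+V)

mainTheorem4 : (M : TimeMonoid) → Dense M → HasSubtraction M → (Prop : Set) →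
    let open TimeMonoid M
        open TEL M Prop
    in (φ : Formula) (u v w : Term) (E : Env) →
       proj₁ (Env.β E (u ⊕ v)) ≡ proj₁ (Env.β E w) →
       (s : M⁺) →
       ((⟨ E , s ⟩⊨ ◇ u (◇ v φ)) ⇔ (⟨ E , s ⟩⊨ ◇ w φ)) ×
       ((⟨ E , s ⟩⊨ □ u (□ v φ)) ⇔ (⟨ E , s ⟩⊨ □ w φ))
mainTheorem4 M dense _ Prop φ u v w E β-split s =
  ◇◇⇔◇ E β-split φ s , □□⇔□ E β-split φ s
  where open Nesting M dense Prop
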